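{- Let $\ell\geq 2$, $w\geq 16$ and $r\geq 6$ be integers, and let $G$ be a graph of $\mathcal{F}(\ell,w,r)$. Then: (1) the eccentricity of the node of label $0$ in $G$ is $r$, and for every $2\leq i\leq \ell$, each node of level $i$ in $G$ is at distance at most $2$ from a gadget; (2) for every $1\leq i\leq \ell$, every path in $G$ from the node of label $0$ to any node of level $i$ that does not pass through the critical node of $G$ has length at least $i$.
   Context: For integers $\ell\geq 2$, $w\geq 4$, $r\geq 6$, let $\beta=w\lfloor w/4\rfloor$ and $m=\lfloor 7\beta/8\rfloor$. The family $\mathcal{F}(\ell,w,r)$ consists of all simple undirected graphs with distinct node labels and port numbers obtained as follows. Step 1: take disjoint sets $V_1,\dots,V_\ell$ of $w$ nodes each (the nodes of $V_i$ are the nodes of level $i$, labeled $w(i-1)+1,\dots,wi$); for each $1\leq i\leq \ell-1$ add edges between $V_i$ and $V_{i+1}$ so that the graph induced by $V_i\cup V_{i+1}$ is a $\lfloor w/4\rfloor$-regular bipartite graph with bipartition $\{V_i,V_{i+1}\}$. Step 2: for each $1\leq i\leq \ell-1$ and each $1\leq j\leq m$, introduce a new node $g^i_j$ (a gadget, labeled $w\ell+(i-1)m+j$); choose a node $u\in V_i$ and a node $v\in V_{i+1}$ that are currently adjacent, remove the edge $\{u,v\}$ and add edges $\{u,g^i_j\}$ and $\{v,g^i_j\}$. Step 3: add a node $v_1$ of label $0$ adjacent to every node of $V_1$, and a node $v_2$ (the critical node, labeled $w\ell+(\ell-1)m+1$) adjacent to every gadget. Step 4: add a path of $r-3$ new nodes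 (the tail), one endpoint of which is joined by an edge to $v_2$; a tail node at distance $d$ from $v_2$ gets label $w\ell+(\ell-1)m+1+d$. Step 5: assign port numbers $0,\dots,\deg(u)-1$ arbitrarily at each node $u$. A path is a sequence of edges; its length is its number of edges. -}

module Defs where

open import Data.Nat using (ℕ; zero; suc; _+_; _*_; _∸_; _≤_; _<_)
open import Data.Nat.DivMod using (_/_)
open import Data.Bool using (Bool; true; false; if_then_else_)
open import Data.List using (List; []; _∷_; map; upTo)
open import Data.Nat.ListAction using (sum)
open import Data.Product using (Σ; ∃; ∃-syntax; _×_; _,_)
open import Data.Sum using (_⊎_)
open import Relation.Binary.PropositionalEquality using (_≡_; _≢_)
open import Relation.Nullary using (¬_)

-- Parameters of the family F(ℓ,w,r).  Nodes are identified with their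
-- (distinct) labels, which are natural numbers.

deg4 : ℕ → ℕ
deg4 w = w / 4

βof : ℕ → ℕ
βof w = w * deg4 w

mof : ℕ → ℕ
mof w = (7 * βof w) / 8

InLevel : (w i x : ℕ) → Set
InLevel w i x = w * (i ∸ 1) < x × x ≤ w * i

gadget : (ℓ w i j : ℕ) → ℕ
gadget ℓ w i j = w * ℓ + (i ∸ 1) * mof w + j

critical : (ℓ w : ℕ) → ℕ
critical ℓ w = w * ℓ + (ℓ ∸ 1) * mof w + 1

countIn : (B : ℕ → ℕ → Bool) (u w i : ℕ) → ℕ
countIn B u w i = sum (map (λ t → if B u (w * (i ∸ 1) + suc t) then 1 else 0) (upTo w))

ValidIdx : (ℓ w i j : ℕ) → Set
ValidIdx ℓ w i j = (1 ≤ i × i < ℓ) × (1 ≤ j × j ≤ mof w)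

-- The choices made in Steps 1–2 of the construction.
--  * B : the edge set of Step 1 (a union of ⌊w/4⌋-regular bipartite
--        graphs between consecutive levels);
--  * gu i j ∈ V_i, gv i j ∈ V_{i+1} : the (currently adjacent) endpoints
--        whose edge is subdivided by the gadget g^i_j.  Sequential removal
--        of currently-present edges is the same as choosing pairwise
--        distinct Step-1 edges.

record Construction (ℓ w r : ℕ) : Set where
  field
    B       : ℕ → ℕ → Bool
    B-sym   : ∀ x y → B x y ≡ B y x
    B-lvl   : ∀ x y → B x y ≡ true →
              ∃[ i ] ((1 ≤ i × i < ℓ) ×
                      ((InLevel w i x × InLevel w (suc i) y) ⊎
                       (InLevel w (suc i) x × InLevel w i y)))
    B-up    : ∀ i → 1 ≤ i → i < ℓ → ∀ u → InLevel w i u →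
              countIn B u w (suc i) ≡ deg4 w
    B-down  : ∀ i → 1 ≤ i → i < ℓ → ∀ v → InLevel w (suc i) v →
              countIn B v w i ≡ deg4 w
    gu gv   : ℕ → ℕ → ℕ
    gu-lvl  : ∀ i j → ValidIdx ℓ w i j → InLevel w i (gu i j)
    gv-lvl  : ∀ i j → ValidIdx ℓ w i j → InLevel w (suc i) (gv i j)
    g-edge  : ∀ i j → ValidIdx ℓ w i j → B (gu i j) (gv i j) ≡ true
    g-dist  : ∀ i j j' → ValidIdx ℓ w i j → ValidIdx ℓ w i j' → j ≢ j' →
              ¬ (gu i j ≡ gu i j' × gv i j ≡ gv i j')

module Graph {ℓ w r : ℕ} (C : Construction ℓ w r) where
  open Construction C

  crit : ℕ
  crit = critical ℓ w

  Vertex : ℕ → Set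
  Vertex x = x ≤ crit + (r ∸ 3)

  Removed : ℕ → ℕ → Set
  Removed x y = ∃[ i ] ∃[ j ] (ValidIdx ℓ w i j ×
                 ((x ≡ gu i j × y ≡ gv i j) ⊎ (x ≡ gv i j × y ≡ gu i j)))

  IsGadget : ℕ → Set
  IsGadget x = ∃[ i ] ∃[ j ] (ValidIdx ℓ w i j × x ≡ gadget ℓ w i j)

  data Edge : ℕ → ℕ → Set where
    level : ∀ {x y} → B x y ≡ true → ¬ Removed x y → Edge x y
    gad-u : ∀ {i j} → ValidIdx ℓ w i j → Edge (gadget ℓ w i j) (gu i j)
    gad-v : ∀ {i j} → ValidIdx ℓ w i j → Edge (gadget ℓ w i j) (gv i j)
    root  : ∀ {y} → InLevel w 1 y → Edge 0 y
    toGad : ∀ {i j} → ValidIdx ℓ w i j → Edge crit (gadget ℓ w i j)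
    tail  : ∀ {d} → suc d ≤ r ∸ 3 → Edge (crit + d) (crit + suc d)

  Adj : ℕ → ℕ → Set
  Adj x y = Edge x y ⊎ Edge y x

  data Walk : ℕ → ℕ → Set where
    []  : ∀ {x} → Walk x x
    _∷_ : ∀ {x y z} → Adj x y → Walk y z → Walk x z

  length : ∀ {x y} → Walk x y → ℕ
  length []       = 0
  length (_ ∷ p) = suc (length p)

  Avoids : ℕ → ∀ {x y} → Walk x y → Set
  Avoids c {x} []      = x ≢ c
  Avoids c {x} (_ ∷ p) = x ≢ c × Avoids c p

  Dist : ℕ → ℕ → ℕ → Set
  Dist x y d = (Σ (Walk x y) λ p → length p ≡ d) × (∀ (p : Walk x y) → d ≤ length p)

  Ecc : ℕ → ℕ → Set
  Ecc x e = (∀ y → Vertex y → ∃[ d ] (Dist x y d × d ≤ e))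
          × (∃[ y ] (Vertex y × Dist x y e))

{-# OPTIONS --safe #-}

-- Both lower bounds come from potentials that change by at most one along an edge. The level
-- potential (i on V_i and on the gadgets g^i_j; 0 on node 0, the critical node and the tail) does so
-- on every edge not at the critical node, which gives (2). The hop potential (0 on node 0, 1 on the
-- levels, 2 on the gadgets, 3 + d at distance d from the critical node along the tail) does so on
-- every edge, so the end of the tail is at distance exactly r. Every other node is within r of
-- node 0: the critical node is three steps away, every gadget four, and every node of level i ≥ 2
-- is within two of a gadget. For the last claim let x ∈ V_{i+1} be no endpoint of a gadget of
-- layer i; then the edges from x to the endpoints in V_i of such gadgets all survive Step 2, and x
-- has a neighbour among these endpoints: otherwise the m edges subdivided in layer i would all
-- start at the w − q non-neighbours of x in V_i, which carry only (w − q)q edges, whereas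
-- m = ⌊7wq/8⌋ > (w − q)q for q = ⌊w/4⌋ ≥ 4. Distances exist because adjacency is decidable and
-- all edges stay below label crit + r − 3, so a shortest walk is found by bounded search.

module Submission where

open import Defs
open import Data.Bool using (Bool; true; false; not; if_then_else_; T)
import Data.Bool as Bool
open import Data.Bool.Properties using (¬-not)
open import Data.Fin as Fin using (Fin; toℕ)
open import Data.Fin.Properties using (injective⇒≤; toℕ<n; toℕ-injective)
open import Data.List as List using (List; []; _∷_; map; upTo; concatMap; filterᵇ)
open import Data.List.Properties using (length-++; map-∘; length-map; length-upTo)
open import Data.List.Membership.Propositional using (_∈_)
open import Data.List.Membership.Propositional.Properties
  using (∈-map⁺; ∈-map⁻; ∈-upTo⁺; ∈-upTo⁻; ∈-concat⁺′; ∈-filter⁺; ∈-filter⁻)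
open import Data.List.Relation.Unary.Any using (here; there; index)
open import Data.List.Relation.Unary.Any.Properties using (lookup-index)
open import Data.Nat
  using (ℕ; zero; suc; _+_; _*_; _∸_; _≤_; _<_; z≤n; s≤s; NonZero; >-nonZero; _/_; _%_; _≟_; _≤?_; _<?_; anyUpTo?)
open import Data.Nat.DivMod using (m≡m%n+[m/n]*n; m%n<n; m*n/n≡m; /-monoˡ-≤)
open import Data.Nat.Induction using (<-rec)
open import Data.Nat.ListAction using (sum)
open import Data.Nat.Properties
open import Data.Nat.Solver using (module +-*-Solver)
open import Data.Product using (Σ; ∃-syntax; _×_; _,_; proj₁; proj₂; uncurry)
open import Data.Sum using (_⊎_; inj₁; inj₂)
open import Data.Unit using (tt)
open import Function using (_∘_)
open import Function.Definitions using (Injective)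
open import Relation.Binary.PropositionalEquality
open import Relation.Nullary using (¬_; Dec; yes; no; ¬?; contradiction)
open import Relation.Nullary.Decidable using (T?; map′; _×-dec_; _⊎-dec_)
open import Relation.Unary using (Decidable)

open +-*-Solver using (solve; _:+_; _:*_; _:=_; con)

module _ {P : ℕ → Set} (P? : Decidable P) where

  least-witness : ∀ {n} → P n → ∃[ d ] (P d × (∀ {k} → P k → d ≤ k))
  least-witness {n} = <-rec (λ n → P n → ∃[ d ] (P d × (∀ {k} → P k → d ≤ k))) step n
    where
    step : ∀ n → (∀ {k} → k < n → P k → ∃[ d ] (P d × (∀ {k} → P k → d ≤ k))) →
           P n → ∃[ d ] (P d × (∀ {k} → P k → d ≤ k))
    step n below pn with anyUpTo? P? n
    ... | yes (k , k<n , pk) = below k<n pk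
    ... | no none            = n , pn , λ {k} pk → ≮⇒≥ (λ k<n → none (k , k<n , pk))

¬InLevel-0 : ∀ {n x} → ¬ InLevel n 0 x
¬InLevel-0 (lt , le) = <-irrefl refl (<-≤-trans lt le)

InLevel⇒0< : ∀ {n i x} → InLevel n i x → 0 < x
InLevel⇒0< (lt , _) = ≤-<-trans z≤n lt

InLevel-unique : ∀ {n i j x} → InLevel n i x → InLevel n j x → i ≡ j
InLevel-unique {n} {i = zero} li _ = contradiction li (¬InLevel-0 {n})
InLevel-unique {n} {j = zero} _ lj = contradiction lj (¬InLevel-0 {n})
InLevel-unique {n} {suc a} {suc b} (a< , ≤sa) (b< , ≤sb) = cong suc (≤-antisym
  (≤-pred (*-cancelˡ-< n a (suc b) (<-≤-trans a< ≤sb)))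
  (≤-pred (*-cancelˡ-< n b (suc a) (<-≤-trans b< ≤sa))))

InLevel-index-≤ : ∀ {n i x k} → InLevel n i x → x ≤ n * k → i ≤ k
InLevel-index-≤ {i = zero} _ _ = z≤n
InLevel-index-≤ {n} {suc a} {k = k} (a< , _) x≤ = *-cancelˡ-< n a k (<-≤-trans a< x≤)

offset-InLevel : ∀ n k {t} → t < n → InLevel n (suc k) (n * k + suc t)
offset-InLevel n k {t} t<n = m<m+n (n * k) (s≤s z≤n) , (begin
  n * k + suc t ≤⟨ +-monoʳ-≤ (n * k) t<n ⟩
  n * k + n     ≡⟨ +-comm (n * k) n ⟩
  n + n * k     ≡⟨ *-suc n k ⟨
  n * suc k     ∎)
  where open ≤-Reasoning

InLevel-offset : ∀ {n k x} → InLevel n (suc k) x → ∃[ t ] (t < n × x ≡ n * k + suc t)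
InLevel-offset {n} {k} {x} (lt , le) = t , t<n , x≡
  where
  t = x ∸ suc (n * k)
  x≡ : x ≡ n * k + suc t
  x≡ = trans (sym (m+[n∸m]≡n lt)) (sym (+-suc (n * k) t))
  t<n : t < n
  t<n = +-cancelˡ-≤ (n * k) (suc t) n
          (subst₂ _≤_ x≡ (trans (*-suc n k) (+-comm n (n * k))) le)

blockIndex : (n : ℕ) .{{_ : NonZero n}} → ℕ → ℕ
blockIndex n x = suc ((x ∸ 1) / n)

InLevel-blockIndex : ∀ n {x} .{{_ : NonZero n}} → 0 < x → InLevel n (blockIndex n x) x
InLevel-blockIndex n {suc y} _ = subst (InLevel n _) (sym y≡) (offset-InLevel n (y / n) (m%n<n y n))
  where
  y≡ : suc y ≡ n * (y / n) + suc (y % n)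
  y≡ = begin
    suc y                     ≡⟨ cong suc (m≡m%n+[m/n]*n y n) ⟩
    suc (y % n + y / n * n)   ≡⟨ cong suc (+-comm (y % n) _) ⟩
    suc (y / n * n + y % n)   ≡⟨ +-suc _ (y % n) ⟨
    y / n * n + suc (y % n)   ≡⟨ cong (_+ suc (y % n)) (*-comm (y / n) n) ⟩
    n * (y / n) + suc (y % n) ∎
    where open ≡-Reasoning

InLevel⇒blockIndex : ∀ {n i x} .{{_ : NonZero n}} → InLevel n i x → blockIndex n x ≡ i
InLevel⇒blockIndex {n} l = InLevel-unique {n} (InLevel-blockIndex n (InLevel⇒0< {n} l)) l

levelNodes : (w i : ℕ) → List ℕ
levelNodes w i = map (λ t → w * (i ∸ 1) + suc t) (upTo w)

length-levelNodes : ∀ w i → List.length (levelNodes w i) ≡ w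
length-levelNodes w i = trans (length-map _ (upTo w)) (length-upTo w)

∈-levelNodes⁺ : ∀ {w i x} → InLevel w i x → x ∈ levelNodes w i
∈-levelNodes⁺ {w} {zero} l = contradiction l (¬InLevel-0 {w})
∈-levelNodes⁺ {w} {suc k} l with InLevel-offset {w} {k} l
... | t , t<w , refl = ∈-map⁺ (λ t → w * k + suc t) (∈-upTo⁺ t<w)

∈-levelNodes⁻ : ∀ {w i x} → 1 ≤ i → x ∈ levelNodes w i → InLevel w i x
∈-levelNodes⁻ {w} {suc k} _ x∈ with ∈-map⁻ (λ t → w * k + suc t) x∈
... | t , t∈ , refl = offset-InLevel w k (∈-upTo⁻ t∈)

module _ {A : Set} where

  sum-indicator≡length-filterᵇ : (b : A → Bool) (xs : List A) →
                                 sum (map (λ a → if b a then 1 else 0) xs) ≡ List.length (filterᵇ b xs)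
  sum-indicator≡length-filterᵇ b [] = refl
  sum-indicator≡length-filterᵇ b (a ∷ xs) with b a
  ... | true  = cong suc (sum-indicator≡length-filterᵇ b xs)
  ... | false = sum-indicator≡length-filterᵇ b xs

  length-filterᵇ-not : (b : A → Bool) (xs : List A) →
                       List.length (filterᵇ b xs) + List.length (filterᵇ (not ∘ b) xs) ≡ List.length xs
  length-filterᵇ-not b [] = refl
  length-filterᵇ-not b (a ∷ xs) with b a
  ... | true  = cong suc (length-filterᵇ-not b xs)
  ... | false = trans (+-suc _ _) (cong suc (length-filterᵇ-not b xs))

  length-concatMap-const : ∀ {B : Set} {n} (f : A → List B) (xs : List A) →
                           (∀ {a} → a ∈ xs → List.length (f a) ≡ n) →
                           List.length (concatMap f xs) ≡ List.length xs * n
  length-concatMap-const f []       _ = refl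
  length-concatMap-const f (a ∷ xs) h =
    trans (length-++ (f a)) (cong₂ _+_ (h (here refl)) (length-concatMap-const f xs (h ∘ there)))

  injection⇒≤length : ∀ {n} {xs : List A} (f : Fin n → A) → Injective _≡_ _≡_ f →
                      (∀ k → f k ∈ xs) → n ≤ List.length xs
  injection⇒≤length {xs = xs} f f-inj f∈xs = injective⇒≤ index-injective
    where
    index-injective : Injective _≡_ _≡_ (index ∘ f∈xs)
    index-injective {k} {k′} eq = f-inj (begin
      f k                              ≡⟨ lookup-index (f∈xs k) ⟩
      List.lookup xs (index (f∈xs k))  ≡⟨ cong (List.lookup xs) eq ⟩
      List.lookup xs (index (f∈xs k′)) ≡⟨ lookup-index (f∈xs k′) ⟨
      f k′                             ∎)
      where open ≡-Reasoning

countIn≡length-filterᵇ : ∀ B u w i → countIn B u w i ≡ List.length (filterᵇ (B u) (levelNodes w i))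
countIn≡length-filterᵇ B u w i =
  trans (cong sum (map-∘ (upTo w))) (sum-indicator≡length-filterᵇ (B u) (levelNodes w i))

-- Opaque: the NonZero (mof w) instance is derived from this proof, and `with` abstractions that
-- unfold it down to the solver steps exhaust memory.
opaque
  [w∸deg4]*deg4<mof : ∀ w → 16 ≤ w → (w ∸ deg4 w) * deg4 w < mof w
  [w∸deg4]*deg4<mof w 16≤w = begin-strict
    (w ∸ q) * q                   <⟨ n<1+n _ ⟩
    suc ((w ∸ q) * q)             ≡⟨ m*n/n≡m (suc ((w ∸ q) * q)) 8 ⟨
    suc ((w ∸ q) * q) * 8 / 8     ≤⟨ /-monoˡ-≤ 8 eightfold ⟩
    7 * (w * q) / 8               ∎
    where
    open ≤-Reasoning
    q s : ℕ
    q = deg4 w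
    s = w % 4
    w≡ : w ≡ s + q * 4
    w≡ = m≡m%n+[m/n]*n w 4
    w∸q≡ : w ∸ q ≡ s + q * 3
    w∸q≡ = trans (cong (_∸ q) (trans w≡ (solve 2 (λ s q → s :+ q :* con 4 := (s :+ q :* con 3) :+ q) refl s q)))
                  (m+n∸n≡m (s + q * 3) q)
    key : ∀ q s → 4 ≤ q → s ≤ 3 → suc ((s + q * 3) * q) * 8 ≤ 7 * ((s + q * 4) * q)
    key q s (s≤s (s≤s (s≤s (s≤s (z≤n {p}))))) s≤3 = +-cancelʳ-≤ (q * s + 8) _ _ (begin
      suc ((s + q * 3) * q) * 8 + (q * s + 8) ≤⟨ +-monoʳ-≤ (suc ((s + q * 3) * q) * 8) (+-monoˡ-≤ 8 (*-monoʳ-≤ q s≤3)) ⟩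
      suc ((s + q * 3) * q) * 8 + (q * 3 + 8) ≤⟨ +-monoʳ-≤ (suc ((s + q * 3) * q) * 8) (m≤m+n _ (44 + 29 * p + 4 * (p * p))) ⟩
      suc ((s + q * 3) * q) * 8 + (q * 3 + 8 + (44 + 29 * p + 4 * (p * p)))
        ≡⟨ solve 2 (λ s p → let q = con 4 :+ p in
             (con 1 :+ (s :+ q :* con 3) :* q) :* con 8 :+ (q :* con 3 :+ con 8 :+ (con 44 :+ con 29 :* p :+ con 4 :* (p :* p)))
             := con 7 :* ((s :+ q :* con 4) :* q) :+ (q :* s :+ con 8)) refl s p ⟩
      7 * ((s + q * 4) * q) + (q * s + 8) ∎)
    eightfold : suc ((w ∸ q) * q) * 8 ≤ 7 * (w * q)
    eightfold = subst₂ (λ a b → suc (a * q) * 8 ≤ 7 * (b * q)) (sym w∸q≡) (sym w≡)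
                  (key q s (/-monoˡ-≤ 4 16≤w) (≤-pred (m%n<n w 4)))

WithinOne : ℕ → ℕ → Set
WithinOne a b = a ≤ suc b × b ≤ suc a

WithinOne-refl : ∀ {a} → WithinOne a a
WithinOne-refl {a} = n≤1+n a , n≤1+n a

WithinOne-suc : ∀ {a} → WithinOne a (suc a)
WithinOne-suc {a} = m≤n⇒m≤1+n (n≤1+n a) , ≤-refl

WithinOne-sym : ∀ {a b} → WithinOne a b → WithinOne b a
WithinOne-sym (a≤ , b≤) = b≤ , a≤

WithinOne-subst : ∀ {a a′ b b′} → a ≡ a′ → b ≡ b′ → WithinOne a′ b′ → WithinOne a b
WithinOne-subst a≡ b≡ = subst₂ WithinOne (sym a≡) (sym b≡)

≤-step-+ : ∀ {a b c n} → b ≤ suc a → c ≤ b + n → c ≤ a + suc n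
≤-step-+ {a} {n = n} b≤1+a c≤b+n = ≤-trans c≤b+n (≤-trans (+-monoˡ-≤ n b≤1+a) (≤-reflexive (sym (+-suc a n))))

module Walks {ℓ w r : ℕ} (C : Construction ℓ w r) where
  open Construction C
  open Graph C

  _++ʷ_ : ∀ {x y z} → Walk x y → Walk y z → Walk x z
  []      ++ʷ q = q
  (a ∷ p) ++ʷ q = a ∷ (p ++ʷ q)

  length-++ʷ : ∀ {x y z} (p : Walk x y) (q : Walk y z) → length (p ++ʷ q) ≡ length p + length q
  length-++ʷ []      q = refl
  length-++ʷ (a ∷ p) q = cong suc (length-++ʷ p q)

  Adj-sym : ∀ {x y} → Adj x y → Adj y x
  Adj-sym (inj₁ e) = inj₂ e
  Adj-sym (inj₂ e) = inj₁ e

  reverseʷ : ∀ {x y} → Walk x y → Walk y x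
  reverseʷ []      = []
  reverseʷ (a ∷ p) = reverseʷ p ++ʷ (Adj-sym a ∷ [])

  length-reverseʷ : ∀ {x y} (p : Walk x y) → length (reverseʷ p) ≡ length p
  length-reverseʷ []      = refl
  length-reverseʷ (a ∷ p) =
    trans (length-++ʷ (reverseʷ p) _) (trans (+-comm (length (reverseʷ p)) 1) (cong suc (length-reverseʷ p)))

  potential-bound : (φ : ℕ → ℕ) → (∀ {x y} → Edge x y → WithinOne (φ x) (φ y)) →
                    ∀ {x y} (p : Walk x y) → φ y ≤ φ x + length p
  potential-bound φ step []           = m≤m+n (φ _) 0
  potential-bound φ step (inj₁ e ∷ p) = ≤-step-+ (proj₂ (step e)) (potential-bound φ step p)
  potential-bound φ step (inj₂ e ∷ p) = ≤-step-+ (proj₁ (step e)) (potential-bound φ step p)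

  Avoids-start : ∀ {c x y} (p : Walk x y) → Avoids c p → x ≢ c
  Avoids-start []      x≢c       = x≢c
  Avoids-start (_ ∷ _) (x≢c , _) = x≢c

  potential-bound-avoiding : (φ : ℕ → ℕ) (c : ℕ) →
                             (∀ {x y} → Edge x y → x ≢ c → y ≢ c → WithinOne (φ x) (φ y)) →
                             ∀ {x y} (p : Walk x y) → Avoids c p → φ y ≤ φ x + length p
  potential-bound-avoiding φ c step [] _ = m≤m+n (φ _) 0
  potential-bound-avoiding φ c step (inj₁ e ∷ p) (x≢c , avoids) =
    ≤-step-+ (proj₂ (step e x≢c (Avoids-start p avoids))) (potential-bound-avoiding φ c step p avoids)
  potential-bound-avoiding φ c step (inj₂ e ∷ p) (x≢c , avoids) =
    ≤-step-+ (proj₁ (step e (Avoids-start p avoids) x≢c)) (potential-bound-avoiding φ c step p avoids)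

  ∃Valid : (ℕ → ℕ → Set) → Set
  ∃Valid Q = ∃[ i ] ∃[ j ] (ValidIdx ℓ w i j × Q i j)

  ValidIdx? : ∀ i j → Dec (ValidIdx ℓ w i j)
  ValidIdx? i j = ((1 ≤? i) ×-dec (i <? ℓ)) ×-dec ((1 ≤? j) ×-dec (j ≤? mof w))

  ∃Valid? : ∀ {Q} → (∀ i j → Dec (Q i j)) → Dec (∃Valid Q)
  ∃Valid? Q? = map′
    (λ (i , _ , j , _ , v , q) → i , j , v , q)
    (λ (i , j , v , q) → i , proj₂ (proj₁ v) , j , s≤s (proj₂ (proj₂ v)) , v , q)
    (anyUpTo? (λ i → anyUpTo? (λ j → ValidIdx? i j ×-dec Q? i j) (suc (mof w))) ℓ)

  EdgeCases : ℕ → ℕ → Set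
  EdgeCases x y =
      (B x y ≡ true × ¬ Removed x y)
    ⊎ ∃Valid (λ i j → x ≡ gadget ℓ w i j × y ≡ gu i j)
    ⊎ ∃Valid (λ i j → x ≡ gadget ℓ w i j × y ≡ gv i j)
    ⊎ (x ≡ 0 × InLevel w 1 y)
    ⊎ ∃Valid (λ i j → x ≡ crit × y ≡ gadget ℓ w i j)
    ⊎ ∃[ d ] (d < r ∸ 3 × x ≡ crit + d × y ≡ crit + suc d)

  EdgeCases⇒Edge : ∀ {x y} → EdgeCases x y → Edge x y
  EdgeCases⇒Edge (inj₁ (b , kept))                                             = level b kept
  EdgeCases⇒Edge (inj₂ (inj₁ (_ , _ , v , refl , refl)))                       = gad-u v
  EdgeCases⇒Edge (inj₂ (inj₂ (inj₁ (_ , _ , v , refl , refl))))                = gad-v v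
  EdgeCases⇒Edge (inj₂ (inj₂ (inj₂ (inj₁ (refl , l)))))                        = root l
  EdgeCases⇒Edge (inj₂ (inj₂ (inj₂ (inj₂ (inj₁ (_ , _ , v , refl , refl)))))) = toGad v
  EdgeCases⇒Edge (inj₂ (inj₂ (inj₂ (inj₂ (inj₂ (_ , d< , refl , refl))))))     = tail d<

  Edge⇒EdgeCases : ∀ {x y} → Edge x y → EdgeCases x y
  Edge⇒EdgeCases (level b kept)    = inj₁ (b , kept)
  Edge⇒EdgeCases (gad-u {i} {j} v) = inj₂ (inj₁ (i , j , v , refl , refl))
  Edge⇒EdgeCases (gad-v {i} {j} v) = inj₂ (inj₂ (inj₁ (i , j , v , refl , refl)))
  Edge⇒EdgeCases (root l)          = inj₂ (inj₂ (inj₂ (inj₁ (refl , l))))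
  Edge⇒EdgeCases (toGad {i} {j} v) = inj₂ (inj₂ (inj₂ (inj₂ (inj₁ (i , j , v , refl , refl)))))
  Edge⇒EdgeCases (tail {d} d<)     = inj₂ (inj₂ (inj₂ (inj₂ (inj₂ (d , d< , refl , refl)))))

  Edge? : ∀ x y → Dec (Edge x y)
  Edge? x y = map′ EdgeCases⇒Edge Edge⇒EdgeCases
      (((B x y Bool.≟ true) ×-dec ¬? (∃Valid? λ i j →
           ((x ≟ gu i j) ×-dec (y ≟ gv i j)) ⊎-dec ((x ≟ gv i j) ×-dec (y ≟ gu i j))))
    ⊎-dec ∃Valid? (λ i j → (x ≟ gadget ℓ w i j) ×-dec (y ≟ gu i j))
    ⊎-dec ∃Valid? (λ i j → (x ≟ gadget ℓ w i j) ×-dec (y ≟ gv i j))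
    ⊎-dec ((x ≟ 0) ×-dec ((w * 0 <? y) ×-dec (y ≤? w * 1)))
    ⊎-dec ∃Valid? (λ i j → (x ≟ crit) ×-dec (y ≟ gadget ℓ w i j))
    ⊎-dec anyUpTo? (λ d → (x ≟ crit + d) ×-dec (y ≟ crit + suc d)) (r ∸ 3))

  Adj? : ∀ x y → Dec (Adj x y)
  Adj? x y = Edge? x y ⊎-dec Edge? y x

  module _ {n : ℕ} (Adj⇒< : ∀ {x y} → Adj x y → y < n) where

    walkOfLength? : ∀ k x y → Dec (Σ (Walk x y) λ p → length p ≡ k)
    walkOfLength? zero x y with x ≟ y
    ... | yes refl = yes ([] , refl)
    ... | no x≢y   = no λ { ([] , _) → x≢y refl ; (_ ∷ _ , ()) }
    walkOfLength? (suc k) x y with anyUpTo? (λ z → Adj? x z ×-dec walkOfLength? k z y) n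
    ... | yes (_ , _ , a , p , refl) = yes (a ∷ p , refl)
    ... | no none = no λ { (_∷_ {y = z} a p , e) → none (z , Adj⇒< a , a , p , suc-injective e) }

    shortest : ∀ {x y} (p : Walk x y) → ∃[ d ] (Dist x y d × d ≤ length p)
    shortest {x} {y} p with least-witness (λ k → walkOfLength? k x y) (p , refl)
    ... | d , walk , least = d , (walk , λ p′ → least (p′ , refl)) , least (p , refl)

module Properties {ℓ w r : ℕ} (C : Construction ℓ w r) (2≤ℓ : 2 ≤ ℓ) (16≤w : 16 ≤ w) (6≤r : 6 ≤ r) where
  open Construction C
  open Graph C
  open Walks C

  q m N : ℕ
  q = deg4 w
  m = mof w
  N = crit + (r ∸ 3)

  0<m : 0 < m
  0<m = ≤-<-trans z≤n ([w∸deg4]*deg4<mof w 16≤w)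

  instance
    w-nonZero : NonZero w
    w-nonZero = >-nonZero (≤-trans (s≤s z≤n) 16≤w)

    m-nonZero : NonZero m
    m-nonZero = >-nonZero 0<m

  level≤wℓ : ∀ {i x} → InLevel w i x → i ≤ ℓ → x ≤ w * ℓ
  level≤wℓ (_ , x≤wi) i≤ℓ = ≤-trans x≤wi (*-monoʳ-≤ w i≤ℓ)

  wℓ<crit : w * ℓ < crit
  wℓ<crit = ≤-trans (s≤s (m≤m+n (w * ℓ) _)) (≤-reflexive (+-comm 1 _))

  1≤ℓ : 1 ≤ ℓ
  1≤ℓ = ≤-trans (s≤s z≤n) 2≤ℓ

  gadget≡ : ∀ i j → gadget ℓ w i j ≡ w * ℓ + ((i ∸ 1) * m + j)
  gadget≡ i j = +-assoc (w * ℓ) ((i ∸ 1) * m) j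

  gadget-offset : ∀ {i j} → ValidIdx ℓ w i j → InLevel m i ((i ∸ 1) * m + j)
  gadget-offset {suc k} {suc t} (_ , (_ , j≤m)) =
    subst (λ o → InLevel m (suc k) (o + suc t)) (*-comm m k) (offset-InLevel m k j≤m)

  gadget-bounds : ∀ {i j} → ValidIdx ℓ w i j → w * ℓ < gadget ℓ w i j × gadget ℓ w i j < crit
  gadget-bounds {i} {j} v@((_ , i<ℓ) , _) =
    subst (w * ℓ <_) (sym (gadget≡ i j)) (m<m+n (w * ℓ) (InLevel⇒0< {m} (gadget-offset v))) ,
    (begin-strict
      gadget ℓ w i j                   ≡⟨ gadget≡ i j ⟩
      w * ℓ + ((i ∸ 1) * m + j)        ≤⟨ +-monoʳ-≤ (w * ℓ) (proj₂ (gadget-offset v)) ⟩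
      w * ℓ + m * i                    ≤⟨ +-monoʳ-≤ (w * ℓ) (*-monoʳ-≤ m (∸-monoˡ-≤ 1 i<ℓ)) ⟩
      w * ℓ + m * (ℓ ∸ 1)              ≡⟨ cong (w * ℓ +_) (*-comm m (ℓ ∸ 1)) ⟩
      w * ℓ + (ℓ ∸ 1) * m              <⟨ m<m+n _ (s≤s z≤n) ⟩
      crit                             ∎)
    where open ≤-Reasoning

  decode-gadget : ∀ {x} → w * ℓ < x → x < crit → IsGadget x
  decode-gadget {x} wℓ<x x<crit with InLevel-offset {m} (InLevel-blockIndex m {x ∸ w * ℓ} (m<n⇒0<n∸m wℓ<x))
  ... | t , t<m , o≡ = suc k , suc t , ((s≤s z≤n , k<ℓ) , (s≤s z≤n , t<m)) , x≡
    where
    o = x ∸ w * ℓ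
    k = (o ∸ 1) / m
    o≤ : o ≤ m * (ℓ ∸ 1)
    o≤ = begin
      x ∸ w * ℓ                   ≤⟨ ∸-monoˡ-≤ (w * ℓ) (≤-pred (subst (suc x ≤_) (+-comm _ 1) x<crit)) ⟩
      w * ℓ + (ℓ ∸ 1) * m ∸ w * ℓ ≡⟨ m+n∸m≡n (w * ℓ) _ ⟩
      (ℓ ∸ 1) * m                 ≡⟨ *-comm (ℓ ∸ 1) m ⟩
      m * (ℓ ∸ 1)                 ∎
      where open ≤-Reasoning
    k<ℓ : suc k < ℓ
    k<ℓ = subst (_≤ ℓ) (+-comm (suc k) 1) (m≤o∸n⇒m+n≤o (suc k) 1≤ℓ
            (InLevel-index-≤ {m} (InLevel-blockIndex m {o} (m<n⇒0<n∸m wℓ<x)) o≤))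
    x≡ : x ≡ gadget ℓ w (suc k) (suc t)
    x≡ = begin
      x                          ≡⟨ m+[n∸m]≡n (<⇒≤ wℓ<x) ⟨
      w * ℓ + o                  ≡⟨ cong (w * ℓ +_) (trans o≡ (cong (_+ suc t) (*-comm m k))) ⟩
      w * ℓ + (k * m + suc t)    ≡⟨ gadget≡ (suc k) (suc t) ⟨
      gadget ℓ w (suc k) (suc t) ∎
      where open ≡-Reasoning

  zoned : (onLevels onGadgets onTail : ℕ → ℕ) → ℕ → ℕ
  zoned L G T zero = 0
  zoned L G T x@(suc _) with x ≤? w * ℓ | x <? crit
  ... | yes _ | _     = L x
  ... | no _  | yes _ = G x
  ... | no _  | no _  = T x

  module _ {L G T : ℕ → ℕ} where

    zoned-level : ∀ {x} → 0 < x → x ≤ w * ℓ → zoned L G T x ≡ L x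
    zoned-level {x@(suc _)} _ x≤wℓ with x ≤? w * ℓ | x <? crit
    ... | yes _   | _ = refl
    ... | no x≰wℓ | _ = contradiction x≤wℓ x≰wℓ

    zoned-gadget : ∀ {x} → w * ℓ < x → x < crit → zoned L G T x ≡ G x
    zoned-gadget {x@(suc _)} wℓ<x x<crit with x ≤? w * ℓ | x <? crit
    ... | yes x≤wℓ | _         = contradiction x≤wℓ (<⇒≱ wℓ<x)
    ... | no _     | yes _     = refl
    ... | no _     | no x≮crit = contradiction x<crit x≮crit

    zoned-tail : ∀ {x} → crit ≤ x → zoned L G T x ≡ T x
    zoned-tail {zero} crit≤0 = contradiction crit≤0 (<⇒≱ (≤-<-trans z≤n wℓ<crit))
    zoned-tail {x@(suc _)} crit≤x with x ≤? w * ℓ | x <? crit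
    ... | yes x≤wℓ | _          = contradiction (≤-trans crit≤x x≤wℓ) (<⇒≱ wℓ<crit)
    ... | no _     | yes x<crit = contradiction x<crit (≤⇒≯ crit≤x)
    ... | no _     | no _       = refl

  levelPotential hopPotential : ℕ → ℕ
  levelPotential = zoned (blockIndex w) (λ x → blockIndex m (x ∸ w * ℓ)) (λ _ → 0)
  hopPotential   = zoned (λ _ → 1) (λ _ → 2) (λ x → 3 + (x ∸ crit))

  levelPotential-level : ∀ {i x} → InLevel w i x → i ≤ ℓ → levelPotential x ≡ i
  levelPotential-level l i≤ℓ = trans (zoned-level (InLevel⇒0< {w} l) (level≤wℓ l i≤ℓ)) (InLevel⇒blockIndex {w} l)

  levelPotential-gadget : ∀ {i j} → ValidIdx ℓ w i j → levelPotential (gadget ℓ w i j) ≡ i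
  levelPotential-gadget {i} {j} v = begin
    levelPotential (gadget ℓ w i j)       ≡⟨ uncurry zoned-gadget (gadget-bounds v) ⟩
    blockIndex m (gadget ℓ w i j ∸ w * ℓ) ≡⟨ cong (blockIndex m) (trans (cong (_∸ w * ℓ) (gadget≡ i j)) (m+n∸m≡n (w * ℓ) _)) ⟩
    blockIndex m ((i ∸ 1) * m + j)        ≡⟨ InLevel⇒blockIndex {m} (gadget-offset v) ⟩
    i                                     ∎
    where open ≡-Reasoning

  levelPotential-tail : ∀ {x} → crit ≤ x → levelPotential x ≡ 0
  levelPotential-tail = zoned-tail

  hopPotential-level : ∀ {i x} → InLevel w i x → i ≤ ℓ → hopPotential x ≡ 1
  hopPotential-level l i≤ℓ = zoned-level (InLevel⇒0< {w} l) (level≤wℓ l i≤ℓ)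

  hopPotential-gadget : ∀ {i j} → ValidIdx ℓ w i j → hopPotential (gadget ℓ w i j) ≡ 2
  hopPotential-gadget v = uncurry zoned-gadget (gadget-bounds v)

  hopPotential-tail : ∀ d → hopPotential (crit + d) ≡ 3 + d
  hopPotential-tail d = trans (zoned-tail (m≤m+n crit d)) (cong (3 +_) (m+n∸m≡n crit d))

  levelPotential-edge : ∀ {x y} → Edge x y → x ≢ crit → y ≢ crit →
                        WithinOne (levelPotential x) (levelPotential y)
  levelPotential-edge {x} {y} (level b _) _ _ with B-lvl x y b
  ... | _ , (_ , i<ℓ) , inj₁ (lx , ly) =
    WithinOne-subst (levelPotential-level lx (<⇒≤ i<ℓ)) (levelPotential-level ly i<ℓ) WithinOne-suc
  ... | _ , (_ , i<ℓ) , inj₂ (lx , ly) =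
    WithinOne-subst (levelPotential-level lx i<ℓ) (levelPotential-level ly (<⇒≤ i<ℓ)) (WithinOne-sym WithinOne-suc)
  levelPotential-edge (gad-u {i} {j} v@((_ , i<ℓ) , _)) _ _ =
    WithinOne-subst (levelPotential-gadget v) (levelPotential-level (gu-lvl i j v) (<⇒≤ i<ℓ)) WithinOne-refl
  levelPotential-edge (gad-v {i} {j} v@((_ , i<ℓ) , _)) _ _ =
    WithinOne-subst (levelPotential-gadget v) (levelPotential-level (gv-lvl i j v) i<ℓ) WithinOne-suc
  levelPotential-edge (root l) _ _ = WithinOne-subst refl (levelPotential-level l 1≤ℓ) WithinOne-suc
  levelPotential-edge (toGad _) crit≢crit _ = contradiction refl crit≢crit
  levelPotential-edge (tail {d} _) _ _ =
    WithinOne-subst (levelPotential-tail (m≤m+n crit d)) (levelPotential-tail (m≤m+n crit (suc d))) WithinOne-refl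

  hopPotential-edge : ∀ {x y} → Edge x y → WithinOne (hopPotential x) (hopPotential y)
  hopPotential-edge {x} {y} (level b _) with B-lvl x y b
  ... | _ , (_ , i<ℓ) , inj₁ (lx , ly) =
    WithinOne-subst (hopPotential-level lx (<⇒≤ i<ℓ)) (hopPotential-level ly i<ℓ) WithinOne-refl
  ... | _ , (_ , i<ℓ) , inj₂ (lx , ly) =
    WithinOne-subst (hopPotential-level lx i<ℓ) (hopPotential-level ly (<⇒≤ i<ℓ)) WithinOne-refl
  hopPotential-edge (gad-u {i} {j} v@((_ , i<ℓ) , _)) =
    WithinOne-subst (hopPotential-gadget v) (hopPotential-level (gu-lvl i j v) (<⇒≤ i<ℓ)) (WithinOne-sym WithinOne-suc)
  hopPotential-edge (gad-v {i} {j} v@((_ , i<ℓ) , _)) =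
    WithinOne-subst (hopPotential-gadget v) (hopPotential-level (gv-lvl i j v) i<ℓ) (WithinOne-sym WithinOne-suc)
  hopPotential-edge (root l) = WithinOne-subst refl (hopPotential-level l 1≤ℓ) WithinOne-suc
  hopPotential-edge (toGad v) =
    WithinOne-subst (trans (cong hopPotential (sym (+-identityʳ crit))) (hopPotential-tail 0)) (hopPotential-gadget v)
      (WithinOne-sym WithinOne-suc)
  hopPotential-edge (tail {d} _) = WithinOne-subst (hopPotential-tail d) (hopPotential-tail (suc d)) WithinOne-suc

  level≤length : ∀ {i x} → InLevel w i x → i ≤ ℓ → (p : Walk 0 x) → Avoids crit p → i ≤ length p
  level≤length {i} l i≤ℓ p avoids =
    subst (_≤ length p) (levelPotential-level l i≤ℓ) (potential-bound-avoiding levelPotential crit levelPotential-edge p avoids)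

  edgesFrom : ℕ → ℕ → List (ℕ × ℕ)
  edgesFrom u i = map (u ,_) (filterᵇ (B u) (levelNodes w (suc i)))

  nonNeighbours : ℕ → ℕ → List ℕ
  nonNeighbours x i = filterᵇ (not ∘ B x) (levelNodes w i)

  edgesFromNonNeighbours : ℕ → ℕ → List (ℕ × ℕ)
  edgesFromNonNeighbours x i = concatMap (λ u → edgesFrom u i) (nonNeighbours x i)

  ∈-edgesFromNonNeighbours : ∀ {x i u v} → InLevel w i u → B x u ≡ false →
                             InLevel w (suc i) v → B u v ≡ true →
                             (u , v) ∈ edgesFromNonNeighbours x i
  ∈-edgesFromNonNeighbours {x} {i} {u} lu xu≡false lv uv≡true =
    ∈-concat⁺′ (∈-map⁺ (u ,_) (∈-filter⁺ (T? ∘ B u) (∈-levelNodes⁺ {w} lv) (subst T (sym uv≡true) tt)))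
               (∈-map⁺ (λ u → edgesFrom u i)
                  (∈-filter⁺ (T? ∘ (not ∘ B x)) (∈-levelNodes⁺ {w} lu) (subst (T ∘ not) (sym xu≡false) tt)))

  length-edgesFrom : ∀ {i u} → 1 ≤ i → i < ℓ → InLevel w i u → List.length (edgesFrom u i) ≡ q
  length-edgesFrom {i} {u} 1≤i i<ℓ lu = begin
    List.length (edgesFrom u i)                        ≡⟨ length-map (u ,_) (filterᵇ (B u) (levelNodes w (suc i))) ⟩
    List.length (filterᵇ (B u) (levelNodes w (suc i))) ≡⟨ countIn≡length-filterᵇ B u w (suc i) ⟨
    countIn B u w (suc i)                              ≡⟨ B-up i 1≤i i<ℓ u lu ⟩
    q                                                  ∎
    where open ≡-Reasoning

  length-nonNeighbours : ∀ {i x} → 1 ≤ i → i < ℓ → InLevel w (suc i) x →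
                         List.length (nonNeighbours x i) ≡ w ∸ q
  length-nonNeighbours {i} {x} 1≤i i<ℓ lx = trans (sym (m+n∸m≡n q _)) (cong (_∸ q) q+|nonNeighbours|≡w)
    where
    q+|nonNeighbours|≡w : q + List.length (nonNeighbours x i) ≡ w
    q+|nonNeighbours|≡w = begin
      q + List.length (nonNeighbours x i)
        ≡⟨ cong (_+ List.length (nonNeighbours x i)) (trans (sym (B-down i 1≤i i<ℓ x lx)) (countIn≡length-filterᵇ B x w i)) ⟩
      List.length (filterᵇ (B x) (levelNodes w i)) + List.length (nonNeighbours x i)
        ≡⟨ length-filterᵇ-not (B x) (levelNodes w i) ⟩
      List.length (levelNodes w i)
        ≡⟨ length-levelNodes w i ⟩
      w ∎
      where open ≡-Reasoning

  length-edgesFromNonNeighbours : ∀ {i x} → 1 ≤ i → i < ℓ → InLevel w (suc i) x →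
                                  List.length (edgesFromNonNeighbours x i) ≡ (w ∸ q) * q
  length-edgesFromNonNeighbours {i} {x} 1≤i i<ℓ lx =
    trans (length-concatMap-const _ (nonNeighbours x i) (length-edgesFrom 1≤i i<ℓ ∘ ∈-levelNodes⁻ {w} 1≤i ∘ proj₁ ∘ ∈-filter⁻ (T? ∘ (not ∘ B x))))
          (cong (_* q) (length-nonNeighbours 1≤i i<ℓ lx))

  ValidIdx-toℕ : ∀ {i} → 1 ≤ i → i < ℓ → (k : Fin m) → ValidIdx ℓ w i (suc (toℕ k))
  ValidIdx-toℕ 1≤i i<ℓ k = (1≤i , i<ℓ) , (s≤s z≤n , toℕ<n k)

  gadgetEdge : ℕ → Fin m → ℕ × ℕ
  gadgetEdge i k = gu i (suc (toℕ k)) , gv i (suc (toℕ k))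

  gadgetEdge-injective : ∀ {i} → 1 ≤ i → i < ℓ → Injective _≡_ _≡_ (gadgetEdge i)
  gadgetEdge-injective {i} 1≤i i<ℓ {k} {k′} eq with k Fin.≟ k′
  ... | yes k≡k′ = k≡k′
  ... | no k≢k′  = contradiction (cong proj₁ eq , cong proj₂ eq)
    (g-dist i _ _ (ValidIdx-toℕ 1≤i i<ℓ k) (ValidIdx-toℕ 1≤i i<ℓ k′) (k≢k′ ∘ toℕ-injective ∘ suc-injective))

  adjacent-gu : ∀ {i x} → 1 ≤ i → i < ℓ → InLevel w (suc i) x → ∃[ j ] (ValidIdx ℓ w i j × B x (gu i j) ≡ true)
  adjacent-gu {i} {x} 1≤i i<ℓ lx with anyUpTo? (λ j → ValidIdx? i j ×-dec (B x (gu i j) Bool.≟ true)) (suc m)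
  ... | yes (j , _ , found) = j , found
  ... | no none = contradiction m≤ (<⇒≱ ([w∸deg4]*deg4<mof w 16≤w))
    where
    valid = ValidIdx-toℕ 1≤i i<ℓ
    far : ∀ k → B x (gu i (suc (toℕ k))) ≡ false
    far k = ¬-not (λ adjacent → none (suc (toℕ k) , s≤s (toℕ<n k) , valid k , adjacent))
    m≤ : m ≤ (w ∸ q) * q
    m≤ = subst (m ≤_) (length-edgesFromNonNeighbours 1≤i i<ℓ lx)
           (injection⇒≤length (gadgetEdge i) (gadgetEdge-injective 1≤i i<ℓ)
              (λ k → ∈-edgesFromNonNeighbours (gu-lvl i _ (valid k)) (far k) (gv-lvl i _ (valid k)) (g-edge i _ (valid k))))

  near-gadget : ∀ {i x} → 1 ≤ i → i < ℓ → InLevel w (suc i) x →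
                ∃[ g ] (IsGadget g × Σ (Walk x g) (λ p → length p ≤ 2))
  near-gadget {i} {x} 1≤i i<ℓ lx with anyUpTo? (λ j → ValidIdx? i j ×-dec (x ≟ gv i j)) (suc m)
  ... | yes (j , _ , v , refl) = gadget ℓ w i j , (i , j , v , refl) , inj₂ (gad-v v) ∷ [] , s≤s z≤n
  ... | no x∉gv with adjacent-gu 1≤i i<ℓ lx
  ...   | j , v , b = gadget ℓ w i j , (i , j , v , refl) , inj₁ (level b kept) ∷ (inj₂ (gad-u v) ∷ []) , ≤-refl
    where
    kept : ¬ Removed x (gu i j)
    kept (i′ , j′ , v′ , inj₁ (x≡gu , gu≡gv)) = <-irrefl (trans i≡ (cong suc i′≡)) (m<n⇒m<1+n (n<1+n i))
      where
      i′≡ : i′ ≡ suc i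
      i′≡ = InLevel-unique {w} (subst (InLevel w i′) (sym x≡gu) (gu-lvl i′ j′ v′)) lx
      i≡ : i ≡ suc i′
      i≡ = InLevel-unique {w} (gu-lvl i j v) (subst (InLevel w (suc i′)) (sym gu≡gv) (gv-lvl i′ j′ v′))
    kept (i′ , j′ , v′ , inj₂ (x≡gv , _)) =
      x∉gv (j′ , s≤s (proj₂ (proj₂ v′)) , subst (λ k → ValidIdx ℓ w k j′) i′≡i v′ , trans x≡gv (cong (λ k → gv k j′) i′≡i))
      where
      i′≡i : i′ ≡ i
      i′≡i = suc-injective (InLevel-unique {w} (subst (InLevel w (suc i′)) (sym x≡gv) (gv-lvl i′ j′ v′)) lx)

  valid₁₁ : ValidIdx ℓ w 1 1
  valid₁₁ = (≤-refl , 2≤ℓ) , (≤-refl , 0<m)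

  origin→crit : Walk 0 crit
  origin→crit = inj₁ (root (gu-lvl 1 1 valid₁₁)) ∷ (inj₂ (gad-u valid₁₁) ∷ (inj₂ (toGad valid₁₁) ∷ []))

  origin→gadget : ∀ {g} → IsGadget g → Σ (Walk 0 g) (λ p → length p ≡ 4)
  origin→gadget (_ , _ , v , refl) = origin→crit ++ʷ (inj₁ (toGad v) ∷ []) , length-++ʷ origin→crit (inj₁ (toGad v) ∷ [])

  crit→tail : ∀ d → d ≤ r ∸ 3 → Σ (Walk crit (crit + d)) (λ p → length p ≡ d)
  crit→tail zero    _ rewrite +-identityʳ crit = [] , refl
  crit→tail (suc d) d< with crit→tail d (<⇒≤ d<)
  ... | p , |p|≡d = p ++ʷ (inj₁ (tail d<) ∷ []) ,
                   trans (length-++ʷ p _) (trans (+-comm (length p) 1) (cong suc |p|≡d))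

  origin→tail : ∀ d → d ≤ r ∸ 3 → Σ (Walk 0 (crit + d)) (λ p → length p ≡ 3 + d)
  origin→tail d d≤ with crit→tail d d≤
  ... | p , |p|≡d = origin→crit ++ʷ p , trans (length-++ʷ origin→crit p) (cong (3 +_) |p|≡d)

  3≤r : 3 ≤ r
  3≤r = ≤-trans (s≤s (s≤s (s≤s z≤n))) 6≤r

  short-walk-to-level : ∀ {i y} → InLevel w i y → i ≤ ℓ → Σ (Walk 0 y) (λ p → length p ≤ r)
  short-walk-to-level {zero} l _ = contradiction l (¬InLevel-0 {w})
  short-walk-to-level {1} l _ = inj₁ (root l) ∷ [] , ≤-trans (s≤s z≤n) 6≤r
  short-walk-to-level {suc (suc i)} l i<ℓ with near-gadget (s≤s z≤n) i<ℓ l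
  ... | g , isg , p , |p|≤2 with origin→gadget isg
  ...   | p₀ , |p₀|≡4 = p₀ ++ʷ reverseʷ p , (begin
    length (p₀ ++ʷ reverseʷ p)      ≡⟨ length-++ʷ p₀ _ ⟩
    length p₀ + length (reverseʷ p) ≡⟨ cong₂ _+_ |p₀|≡4 (length-reverseʷ p) ⟩
    4 + length p                    ≤⟨ +-monoʳ-≤ 4 |p|≤2 ⟩
    6                               ≤⟨ 6≤r ⟩
    r                               ∎)
    where open ≤-Reasoning

  short-walk-to-tail : ∀ d → d ≤ r ∸ 3 → Σ (Walk 0 (crit + d)) (λ p → length p ≤ r)
  short-walk-to-tail d d≤ with origin→tail d d≤
  ... | p , |p|≡3+d = p , (begin
    length p    ≡⟨ |p|≡3+d ⟩
    3 + d       ≤⟨ +-monoʳ-≤ 3 d≤ ⟩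
    3 + (r ∸ 3) ≡⟨ m+[n∸m]≡n 3≤r ⟩
    r           ∎)
    where open ≤-Reasoning

  short-walk : ∀ y → Vertex y → Σ (Walk 0 y) (λ p → length p ≤ r)
  short-walk zero _ = [] , z≤n
  short-walk y@(suc _) y≤N with y ≤? w * ℓ | y <? crit
  ... | yes y≤wℓ | _ = short-walk-to-level l (InLevel-index-≤ {w} l y≤wℓ)
    where l = InLevel-blockIndex w (s≤s z≤n)
  ... | no y≰wℓ | yes y<crit with origin→gadget (decode-gadget (≰⇒> y≰wℓ) y<crit)
  ...   | p , |p|≡4 = p , subst (_≤ r) (sym |p|≡4) (≤-trans (s≤s (s≤s (s≤s (s≤s z≤n)))) 6≤r)
  short-walk y@(suc _) y≤N | no _ | no y≮crit =
    subst (λ z → Σ (Walk 0 z) (λ p → length p ≤ r)) (m+[n∸m]≡n (≮⇒≥ y≮crit))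
      (short-walk-to-tail (y ∸ crit) (subst (y ∸ crit ≤_) (m+n∸m≡n crit (r ∸ 3)) (∸-monoˡ-≤ crit y≤N)))

  level≤N : ∀ {i x} → InLevel w i x → i ≤ ℓ → x ≤ N
  level≤N l i≤ℓ = ≤-trans (level≤wℓ l i≤ℓ) (≤-trans (<⇒≤ wℓ<crit) (m≤m+n crit _))

  gadget≤N : ∀ {i j} → ValidIdx ℓ w i j → gadget ℓ w i j ≤ N
  gadget≤N v = ≤-trans (<⇒≤ (proj₂ (gadget-bounds v))) (m≤m+n crit _)

  Edge-endpoints≤N : ∀ {x y} → Edge x y → x ≤ N × y ≤ N
  Edge-endpoints≤N {x} {y} (level b _) with B-lvl x y b
  ... | _ , (_ , i<ℓ) , inj₁ (lx , ly) = level≤N lx (<⇒≤ i<ℓ) , level≤N ly i<ℓ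
  ... | _ , (_ , i<ℓ) , inj₂ (lx , ly) = level≤N lx i<ℓ , level≤N ly (<⇒≤ i<ℓ)
  Edge-endpoints≤N (gad-u {i} {j} v@((_ , i<ℓ) , _)) = gadget≤N v , level≤N (gu-lvl i j v) (<⇒≤ i<ℓ)
  Edge-endpoints≤N (gad-v {i} {j} v@((_ , i<ℓ) , _)) = gadget≤N v , level≤N (gv-lvl i j v) i<ℓ
  Edge-endpoints≤N (root l)      = z≤n , level≤N l 1≤ℓ
  Edge-endpoints≤N (toGad v)     = m≤m+n crit _ , gadget≤N v
  Edge-endpoints≤N (tail {d} d<) = +-monoʳ-≤ crit (<⇒≤ d<) , +-monoʳ-≤ crit d<

  Adj⇒<1+N : ∀ {x y} → Adj x y → y < suc N
  Adj⇒<1+N (inj₁ e) = s≤s (proj₂ (Edge-endpoints≤N e))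
  Adj⇒<1+N (inj₂ e) = s≤s (proj₁ (Edge-endpoints≤N e))

  eccentricity : Ecc 0 r
  eccentricity = (λ y y∈V → bounded-distance (short-walk y y∈V)) , N , ≤-refl , farthest
    where
    bounded-distance : ∀ {y} → Σ (Walk 0 y) (λ p → length p ≤ r) → ∃[ d ] (Dist 0 y d × d ≤ r)
    bounded-distance (p , |p|≤r) with shortest Adj⇒<1+N p
    ... | d , dist , d≤|p| = d , dist , ≤-trans d≤|p| |p|≤r
    r≡ : 3 + (r ∸ 3) ≡ r
    r≡ = m+[n∸m]≡n 3≤r
    farthest : Dist 0 N r
    farthest with origin→tail (r ∸ 3) ≤-refl
    ... | p , |p|≡ = (p , trans |p|≡ r≡) ,
                     λ p′ → subst (_≤ length p′) (trans (hopPotential-tail (r ∸ 3)) r≡)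
                                  (potential-bound hopPotential hopPotential-edge p′)

lemma3 : (ℓ w r : ℕ) → 2 ≤ ℓ → 16 ≤ w → 6 ≤ r → (C : Construction ℓ w r) →
         (Graph.Ecc C 0 r
           × (∀ i → 2 ≤ i → i ≤ ℓ → ∀ x → InLevel w i x →
                ∃[ g ] (Graph.IsGadget C g × Σ (Graph.Walk C x g) (λ p → Graph.length C p ≤ 2))))
         × (∀ i → 1 ≤ i → i ≤ ℓ → ∀ x → InLevel w i x → (p : Graph.Walk C 0 x) →
              Graph.Avoids C (Graph.crit C) p → i ≤ Graph.length C p)
lemma3 ℓ w r 2≤ℓ 16≤w 6≤r C =
  (eccentricity , λ { (suc i) (s≤s 1≤i) i<ℓ _ → near-gadget 1≤i i<ℓ }) ,
  λ _ _ i≤ℓ _ l → level≤length l i≤ℓ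
  where open Properties C 2≤ℓ 16≤w 6≤r
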